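{- Let $k_1,k_2$ be positive integers and $(a_i)_{i\ge1}$, $(b_i)_{i\ge1}$ arbitrary sequences (of complex numbers). Then $$\sum_{i=0}^{k_2-1}\binom{k_1+i-1}{k_1-1}\sum_{j=0}^{k_1+i-1}(-1)^{k_2-i}\binom{k_2-i+j-1}{j}a_{k_2-i+j}b_{k_1+i-j}=-\sum_{i=0}^{k_1-1}\binom{k_2+i-1}{k_2-1}a_{k_1-i}b_{k_2+i}$$ and $$\sum_{i=0}^{k_2-1}\binom{k_1+i-1}{k_1-1}\sum_{j=0}^{k_2-i-1}(-1)^{j}\binom{k_1+i+j-1}{j}a_{k_1+i+j}b_{k_2-i-j}=a_{k_1}b_{k_2}.$$ -}

module Defs where

open import Level using (Level)
open import Data.Nat using (ℕ; zero; suc; _∸_) renaming (_+_ to _+ℕ_)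
open import Data.Nat.Combinatorics using (_C_)
open import Algebra.Bundles using (CommutativeRing)

module RingOps {c ℓ : Level} (R : CommutativeRing c ℓ) where
  open CommutativeRing R using (Carrier; _+_; _*_; -_; 0#; 1#)

  ∑<_ : ℕ → (ℕ → Carrier) → Carrier
  (∑< zero) f = 0#
  (∑< suc n) f = (∑< n) f + f n

  ⟦_⟧ : ℕ → Carrier
  ⟦ zero ⟧ = 0#
  ⟦ suc n ⟧ = 1# + ⟦ n ⟧

  sgn : ℕ → Carrier
  sgn zero = 1#
  sgn (suc m) = - (sgn m)

  binom : ℕ → ℕ → Carrier
  binom n k = ⟦ n C k ⟧

  lhs₁ : ℕ → ℕ → (ℕ → Carrier) → (ℕ → Carrier) → Carrier
  lhs₁ k₁ k₂ a b =
    (∑< k₂) λ i → binom (k₁ +ℕ i ∸ 1) (k₁ ∸ 1) *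
      (∑< (k₁ +ℕ i)) λ j →
        sgn (k₂ ∸ i) * binom (k₂ ∸ i +ℕ j ∸ 1) j * a (k₂ ∸ i +ℕ j) * b (k₁ +ℕ i ∸ j)

  rhs₁ : ℕ → ℕ → (ℕ → Carrier) → (ℕ → Carrier) → Carrier
  rhs₁ k₁ k₂ a b =
    - ((∑< k₁) λ i → binom (k₂ +ℕ i ∸ 1) (k₂ ∸ 1) * a (k₁ ∸ i) * b (k₂ +ℕ i))

  lhs₂ : ℕ → ℕ → (ℕ → Carrier) → (ℕ → Carrier) → Carrier
  lhs₂ k₁ k₂ a b =
    (∑< k₂) λ i → binom (k₁ +ℕ i ∸ 1) (k₁ ∸ 1) *
      (∑< (k₂ ∸ i)) λ j →
        sgn j * binom (k₁ +ℕ i +ℕ j ∸ 1) j * a (k₁ +ℕ i +ℕ j) * b (k₂ ∸ i ∸ j)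

{-# OPTIONS --safe #-}
module Submission where

-- Regrouping the double sums along antidiagonals turns the coefficient of each product
-- a_p b_q into an alternating binomial sum  ∇ m f n = ∑_{i ≤ m} (-1)^i C(m,i) f(n - i),
-- the m-th backward difference of f at n, which satisfies
-- ∇ (m+1) f (n+1) = ∇ m f (n+1) - ∇ m f n  by Pascal's rule.
-- In the second identity the revision C(N,i) C(N-i,x) = C(N,x) C(N-x,i) makes f constant,
-- so only m = 0 survives, leaving a_{k₁} b_{k₂}.  In the first, f = C(·, k₁-1), whose m-th
-- difference at n is C(n-m, k₁-1-m) for m < k₁ and 0 beyond; read backwards, the
-- right-hand side has exactly these coefficients.

open import Defs
open import Level using (Level)
open import Data.Nat as ℕ using (ℕ; zero; suc; _∸_; _≤_; _<_; z≤n; s≤s; _!)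
import Data.Nat.Properties as ℕₚ
open import Data.Nat.Combinatorics
  using (_C_; nCk≡n!/k![n-k]!; k![n∸k]!∣n!; nCk≡nC[n∸k]; k>n⇒nCk≡0; nCk+nC[k+1]≡[n+1]C[k+1]; nCn≡1)
open import Data.Nat.DivMod using (_/_; m/n*n≡m)
open import Data.Product using (_×_; _,_)
open import Data.Sum using (inj₁; inj₂)
open import Algebra.Bundles using (CommutativeRing)
open import Relation.Binary.PropositionalEquality as ≡ using (_≡_; cong; cong₂)

module _ where
  open import Data.Nat using (_+_; _*_)
  open ℕₚ
  open ≡.≡-Reasoning
  open import Data.Nat.Tactic.RingSolver using (solve-∀)

  nCk*[k!*[n∸k]!]≡n! : ∀ {n k} → k ≤ n → (n C k) * (k ! * (n ∸ k) !) ≡ n !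
  nCk*[k!*[n∸k]!]≡n! {n} {k} k≤n = begin
    (n C k) * (k ! * (n ∸ k) !)                 ≡⟨ cong (_* (k ! * (n ∸ k) !)) (nCk≡n!/k![n-k]! k≤n) ⟩
    n ! / (k ! * (n ∸ k) !) * (k ! * (n ∸ k) !) ≡⟨ m/n*n≡m (k![n∸k]!∣n! k≤n) ⟩
    n !                                         ∎
    where instance _ = k !* (n ∸ k) !≢0

  -- Both sides, multiplied by i! j! (n - i - j)!, equal n!.
  nCi*[n∸i]Cj≡nCj*[n∸j]Ci : ∀ {n i j} → i + j ≤ n → (n C i) * ((n ∸ i) C j) ≡ (n C j) * ((n ∸ j) C i)
  nCi*[n∸i]Cj≡nCj*[n∸j]Ci {n} {i} {j} i+j≤n = *-cancelʳ-≡ _ _ (i ! * j ! * (n ∸ i ∸ j) !) (begin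
      (n C i) * ((n ∸ i) C j) * (i ! * j ! * (n ∸ i ∸ j) !) ≡⟨ times-factorials i j i+j≤n ⟩
      n !                                                   ≡⟨ times-factorials j i j+i≤n ⟨
      (n C j) * ((n ∸ j) C i) * (j ! * i ! * (n ∸ j ∸ i) !) ≡⟨ cong ((n C j) * ((n ∸ j) C i) *_) swap ⟩
      (n C j) * ((n ∸ j) C i) * (i ! * j ! * (n ∸ i ∸ j) !) ∎)
    where
    instance
      _ = i !* j !≢0
      _ = (n ∸ i ∸ j) !≢0
      _ = m*n≢0 (i ! * j !) ((n ∸ i ∸ j) !)
    j+i≤n : j + i ≤ n
    j+i≤n = ≡.subst (_≤ n) (+-comm i j) i+j≤n
    swap : j ! * i ! * (n ∸ j ∸ i) ! ≡ i ! * j ! * (n ∸ i ∸ j) !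
    swap = cong₂ _*_ (*-comm (j !) (i !)) (cong _! (begin
      n ∸ j ∸ i   ≡⟨ ∸-+-assoc n j i ⟩
      n ∸ (j + i) ≡⟨ cong (n ∸_) (+-comm j i) ⟩
      n ∸ (i + j) ≡⟨ ∸-+-assoc n i j ⟨
      n ∸ i ∸ j   ∎))
    regroup : ∀ A B a b c → A * B * (a * b * c) ≡ A * (a * (B * (b * c)))
    regroup = solve-∀
    times-factorials : ∀ p q → p + q ≤ n → (n C p) * ((n ∸ p) C q) * (p ! * q ! * (n ∸ p ∸ q) !) ≡ n !
    times-factorials p q p+q≤n = begin
      (n C p) * ((n ∸ p) C q) * (p ! * q ! * (n ∸ p ∸ q) !)
        ≡⟨ regroup (n C p) ((n ∸ p) C q) (p !) (q !) ((n ∸ p ∸ q) !) ⟩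
      (n C p) * (p ! * (((n ∸ p) C q) * (q ! * (n ∸ p ∸ q) !)))
        ≡⟨ cong (λ z → (n C p) * (p ! * z)) (nCk*[k!*[n∸k]!]≡n! q≤n∸p) ⟩
      (n C p) * (p ! * (n ∸ p) !)
        ≡⟨ nCk*[k!*[n∸k]!]≡n! (m+n≤o⇒m≤o p p+q≤n) ⟩
      n ! ∎
      where q≤n∸p = m+n≤o⇒m≤o∸n q (≡.subst (_≤ n) (+-comm p q) p+q≤n)

  [m+n]Cm≡[m+n]Cn : ∀ m n → (m + n) C m ≡ (m + n) C n
  [m+n]Cm≡[m+n]Cn m n = ≡.trans (nCk≡nC[n∸k] (m≤m+n m n)) (cong ((m + n) C_) (m+n∸m≡n m n))

  [n∸i]∸[m∸i]≡n∸m : ∀ {i m} n → i ≤ m → n ∸ i ∸ (m ∸ i) ≡ n ∸ m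
  [n∸i]∸[m∸i]≡n∸m {i} {m} n i≤m = ≡.trans (∸-+-assoc n i (m ∸ i)) (cong (n ∸_) (m+[n∸m]≡n i≤m))

  [1+m]∸[m∸n]≡1+n : ∀ {m n} → n ≤ m → suc m ∸ (m ∸ n) ≡ suc n
  [1+m]∸[m∸n]≡1+n {m} {n} n≤m = ≡.trans (+-∸-assoc 1 (m∸n≤m m n)) (cong suc (m∸[m∸n]≡n n≤m))

module _ {c ℓ : Level} (R : CommutativeRing c ℓ) where
  open CommutativeRing R
  open RingOps R
  open import Algebra.Properties.Ring ring using (-‿distribˡ-*; -0#≈0#; -‿+-comm; //-rightDividesʳ)
  open import Algebra.Solver.Ring.NaturalCoefficients.Default commutativeSemiring using (solve; _:+_; _:*_; _:=_)
  open import Algebra.Properties.CommutativeSemigroup +-commutativeSemigroup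
    using () renaming (interchange to +-interchange)
  open import Relation.Binary.Reasoning.Setoid setoid
  open ℕₚ using (≤-pred; ≤-refl; ≤-trans; m<n⇒m<1+n; n<1+n; m≤n⇒m≤1+n; m≤n⇒m<n∨m≡n; m≤m+n; m≤n+m
                ; +-∸-assoc; n∸n≡0; m∸[m∸n]≡n; m+[n∸m]≡n; m+n∸m≡n; m+n∸n≡m; ∸-monoʳ-<; +-monoʳ-≤)

  ∑-cong : ∀ n {f g : ℕ → Carrier} → (∀ {i} → i < n → f i ≈ g i) → (∑< n) f ≈ (∑< n) g
  ∑-cong zero    f≈g = refl
  ∑-cong (suc n) f≈g = +-cong (∑-cong n (λ i<n → f≈g (m<n⇒m<1+n i<n))) (f≈g (n<1+n n))

  ∑-cong-bound : ∀ {m n} (f : ℕ → Carrier) → m ≡ n → (∑< m) f ≈ (∑< n) f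
  ∑-cong-bound f ≡.refl = refl

  ∑-distrib-+ : ∀ n (f g : ℕ → Carrier) → (∑< n) (λ i → f i + g i) ≈ (∑< n) f + (∑< n) g
  ∑-distrib-+ zero    f g = sym (+-identityˡ 0#)
  ∑-distrib-+ (suc n) f g = trans (+-congʳ (∑-distrib-+ n f g)) (+-interchange _ _ _ _)

  *-distribˡ-∑ : ∀ n x (f : ℕ → Carrier) → x * (∑< n) f ≈ (∑< n) (λ i → x * f i)
  *-distribˡ-∑ zero    x f = zeroʳ x
  *-distribˡ-∑ (suc n) x f = trans (distribˡ x _ _) (+-congʳ (*-distribˡ-∑ n x f))

  *-distribʳ-∑ : ∀ n x (f : ℕ → Carrier) → (∑< n) f * x ≈ (∑< n) (λ i → f i * x)
  *-distribʳ-∑ zero    x f = zeroˡ x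
  *-distribʳ-∑ (suc n) x f = trans (distribʳ x _ _) (+-congʳ (*-distribʳ-∑ n x f))

  -‿distrib-∑ : ∀ n (f : ℕ → Carrier) → - (∑< n) f ≈ (∑< n) (λ i → - f i)
  -‿distrib-∑ zero    f = -0#≈0#
  -‿distrib-∑ (suc n) f = trans (sym (-‿+-comm _ _)) (+-congʳ (-‿distrib-∑ n f))

  ∑-head : ∀ n (f : ℕ → Carrier) → (∑< suc n) f ≈ f 0 + (∑< n) (λ i → f (suc i))
  ∑-head zero    f = +-comm 0# (f 0)
  ∑-head (suc n) f = trans (+-congʳ (∑-head n f)) (+-assoc _ _ _)

  ∑-reverse : ∀ n (f : ℕ → Carrier) → (∑< n) f ≈ (∑< n) (λ i → f (n ∸ suc i))
  ∑-reverse zero    f = refl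
  ∑-reverse (suc n) f = trans (+-congʳ (∑-reverse n f)) (trans (+-comm _ _) (sym (∑-head n _)))

  ∑-truncate : ∀ {m n} (f : ℕ → Carrier) → m ≤ n → (∀ {i} → m ≤ i → i < n → f i ≈ 0#) → (∑< n) f ≈ (∑< m) f
  ∑-truncate {n = zero}  f z≤n f≈0 = refl
  ∑-truncate {n = suc n} f m≤1+n f≈0 with m≤n⇒m<n∨m≡n m≤1+n
  ... | inj₂ ≡.refl      = refl
  ... | inj₁ (s≤s m≤n) =
    trans (+-cong (∑-truncate f m≤n (λ m≤i i<n → f≈0 m≤i (m<n⇒m<1+n i<n))) (f≈0 m≤n (n<1+n n)))
          (+-identityʳ _)

  ∑-triangle : ∀ n (g : ℕ → ℕ → Carrier) →
               (∑< n) (λ i → (∑< (n ∸ i)) (g i)) ≈ (∑< n) (λ m → (∑< suc m) (λ i → g i (m ∸ i)))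
  ∑-triangle zero    g = refl
  ∑-triangle (suc n) g = begin
      (∑< suc n) (λ i → (∑< (suc n ∸ i)) (g i))
    ≈⟨ ∑-cong (suc n) (λ {i} i<1+n → ∑-cong-bound (g i) (+-∸-assoc 1 (≤-pred i<1+n))) ⟩
      (∑< suc n) (λ i → (∑< (n ∸ i)) (g i) + g i (n ∸ i))
    ≈⟨ ∑-distrib-+ (suc n) _ _ ⟩
      ((∑< n) (λ i → (∑< (n ∸ i)) (g i)) + (∑< (n ∸ n)) (g n)) + (∑< suc n) (λ i → g i (n ∸ i))
    ≈⟨ +-congʳ (trans (+-congˡ (∑-cong-bound (g n) (n∸n≡0 n))) (+-identityʳ _)) ⟩
      (∑< n) (λ i → (∑< (n ∸ i)) (g i)) + (∑< suc n) (λ i → g i (n ∸ i))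
    ≈⟨ +-congʳ (∑-triangle n g) ⟩
      (∑< suc n) (λ m → (∑< suc m) (λ i → g i (m ∸ i)))
    ∎

  ⟦⟧-cong : ∀ {m n} → m ≡ n → ⟦ m ⟧ ≈ ⟦ n ⟧
  ⟦⟧-cong m≡n = reflexive (cong ⟦_⟧ m≡n)

  ⟦⟧-homo-+ : ∀ m n → ⟦ m ℕ.+ n ⟧ ≈ ⟦ m ⟧ + ⟦ n ⟧
  ⟦⟧-homo-+ zero    n = sym (+-identityˡ _)
  ⟦⟧-homo-+ (suc m) n = trans (+-congˡ (⟦⟧-homo-+ m n)) (sym (+-assoc _ _ _))

  ⟦⟧-homo-* : ∀ m n → ⟦ m ℕ.* n ⟧ ≈ ⟦ m ⟧ * ⟦ n ⟧
  ⟦⟧-homo-* zero    n = sym (zeroˡ _)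
  ⟦⟧-homo-* (suc m) n = begin
    ⟦ n ℕ.+ m ℕ.* n ⟧         ≈⟨ ⟦⟧-homo-+ n (m ℕ.* n) ⟩
    ⟦ n ⟧ + ⟦ m ℕ.* n ⟧       ≈⟨ +-cong (sym (*-identityˡ _)) (⟦⟧-homo-* m n) ⟩
    1# * ⟦ n ⟧ + ⟦ m ⟧ * ⟦ n ⟧ ≈⟨ distribʳ _ _ _ ⟨
    (1# + ⟦ m ⟧) * ⟦ n ⟧      ∎

  binom-n0≈1 : ∀ n → binom n 0 ≈ 1#
  binom-n0≈1 n = +-identityʳ 1#

  binom-nn≈1 : ∀ n → binom n n ≈ 1#
  binom-nn≈1 n = trans (⟦⟧-cong (nCn≡1 n)) (binom-n0≈1 0)

  k>n⇒binom-nk≈0 : ∀ {n k} → n < k → binom n k ≈ 0#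
  k>n⇒binom-nk≈0 n<k = ⟦⟧-cong (k>n⇒nCk≡0 n<k)

  binom-pascal : ∀ n k → binom n k + binom n (suc k) ≈ binom (suc n) (suc k)
  binom-pascal n k = trans (sym (⟦⟧-homo-+ (n C k) (n C suc k))) (⟦⟧-cong (nCk+nC[k+1]≡[n+1]C[k+1] n k))

  sgn0*binom-n0*x≈x : ∀ n x → sgn 0 * binom n 0 * x ≈ x
  sgn0*binom-n0*x≈x n x = trans (*-congʳ (trans (*-identityˡ _) (binom-n0≈1 n))) (*-identityˡ x)

  ∇ : ℕ → (ℕ → Carrier) → ℕ → Carrier
  ∇ m f n = (∑< suc m) λ i → sgn i * binom m i * f (n ∸ i)

  ∇-zero : ∀ f n → ∇ 0 f n ≈ f n
  ∇-zero f n = trans (+-identityˡ _) (sgn0*binom-n0*x≈x 0 (f n))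

  ∑-sgn-suc≈-∇ : ∀ m f n → (∑< suc m) (λ i → sgn (suc i) * binom m i * f (n ∸ i)) ≈ - ∇ m f n
  ∑-sgn-suc≈-∇ m f n = sym (trans (-‿distrib-∑ (suc m) _) (∑-cong (suc m) (λ _ → -‿distribˡ-*-* _ _ _)))
    where
    -‿distribˡ-*-* : ∀ x y z → - (x * y * z) ≈ - x * y * z
    -‿distribˡ-*-* x y z = trans (-‿distribˡ-* _ z) (*-congʳ (-‿distribˡ-* x y))

  ∇-unfold : ∀ m f n → ∇ m f (suc n) ≈ f (suc n) + (∑< m) (λ i → sgn (suc i) * binom m (suc i) * f (n ∸ i))
  ∇-unfold m f n = trans (∑-head m _) (+-congʳ (sgn0*binom-n0*x≈x m (f (suc n))))

  ∇-suc : ∀ m f n → ∇ (suc m) f (suc n) ≈ ∇ m f (suc n) - ∇ m f n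
  ∇-suc m f n = begin
      ∇ (suc m) f (suc n)
    ≈⟨ ∇-unfold (suc m) f n ⟩
      f (suc n) + (∑< suc m) (λ i → sgn (suc i) * binom (suc m) (suc i) * f (n ∸ i))
    ≈⟨ +-congˡ (∑-cong (suc m) (λ _ → pascal-split _)) ⟩
      f (suc n) + (∑< suc m) (λ i → h i + g i)
    ≈⟨ +-congˡ (∑-distrib-+ (suc m) h g) ⟩
      f (suc n) + ((∑< m) h + h m + (∑< suc m) g)
    ≈⟨ +-congˡ (+-congʳ (trans (+-congˡ h-last≈0) (+-identityʳ _))) ⟩
      f (suc n) + ((∑< m) h + (∑< suc m) g)
    ≈⟨ +-assoc _ _ _ ⟨
      (f (suc n) + (∑< m) h) + (∑< suc m) g
    ≈⟨ +-cong (∇-unfold m f n) (sym (∑-sgn-suc≈-∇ m f n)) ⟨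
      ∇ m f (suc n) - ∇ m f n
    ∎
    where
    g h : ℕ → Carrier
    g i = sgn (suc i) * binom m i * f (n ∸ i)
    h i = sgn (suc i) * binom m (suc i) * f (n ∸ i)
    pascal-split : ∀ i → sgn (suc i) * binom (suc m) (suc i) * f (n ∸ i) ≈ h i + g i
    pascal-split i = trans (*-congʳ (*-congˡ (sym (binom-pascal m i))))
      (solve 4 (λ s p q x → s :* (p :+ q) :* x := s :* q :* x :+ s :* p :* x) refl _ _ _ _)
    h-last≈0 : h m ≈ 0#
    h-last≈0 = trans (*-congʳ (trans (*-congˡ (k>n⇒binom-nk≈0 (n<1+n m))) (zeroʳ _))) (zeroˡ _)

  ∇-const : ∀ m x n → ∇ (suc m) (λ _ → x) n ≈ 0#
  ∇-const m x n = trans (∇-suc m (λ _ → x) n) (-‿inverseʳ _)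

  ∇-binom : ∀ {m r n} → m ≤ r → m ≤ n → ∇ m (λ k → binom k r) n ≈ binom (n ∸ m) (r ∸ m)
  ∇-binom {zero} {r} {n} _ _ = ∇-zero (λ k → binom k r) n
  ∇-binom {suc m} {suc r} {suc n} (s≤s m≤r) (s≤s m≤n) = begin
      ∇ (suc m) (λ k → binom k (suc r)) (suc n)
    ≈⟨ ∇-suc m (λ k → binom k (suc r)) n ⟩
      ∇ m (λ k → binom k (suc r)) (suc n) - ∇ m (λ k → binom k (suc r)) n
    ≈⟨ +-cong (∇-binom (m≤n⇒m≤1+n m≤r) (m≤n⇒m≤1+n m≤n)) (-‿cong (∇-binom (m≤n⇒m≤1+n m≤r) m≤n)) ⟩
      binom (suc n ∸ m) (suc r ∸ m) - binom (n ∸ m) (suc r ∸ m)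
    ≡⟨ cong₂ (λ p q → binom p q - binom (n ∸ m) q) (+-∸-assoc 1 m≤n) (+-∸-assoc 1 m≤r) ⟩
      binom (suc (n ∸ m)) (suc (r ∸ m)) - binom (n ∸ m) (suc (r ∸ m))
    ≈⟨ +-congʳ (binom-pascal (n ∸ m) (r ∸ m)) ⟨
      binom (n ∸ m) (r ∸ m) + binom (n ∸ m) (suc (r ∸ m)) - binom (n ∸ m) (suc (r ∸ m))
    ≈⟨ //-rightDividesʳ _ _ ⟩
      binom (n ∸ m) (r ∸ m)
    ∎

  ∇-binom-vanish : ∀ {m r n} → r < m → m ≤ n → ∇ m (λ k → binom k r) n ≈ 0#
  ∇-binom-vanish {suc m} {r} {suc n} (s≤s r≤m) (s≤s m≤n) with m≤n⇒m<n∨m≡n r≤m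
  ... | inj₁ r<m = begin
      ∇ (suc m) (λ k → binom k r) (suc n)
    ≈⟨ ∇-suc m (λ k → binom k r) n ⟩
      ∇ m (λ k → binom k r) (suc n) - ∇ m (λ k → binom k r) n
    ≈⟨ +-cong (∇-binom-vanish r<m (m≤n⇒m≤1+n m≤n)) (-‿cong (∇-binom-vanish r<m m≤n)) ⟩
      0# - 0#
    ≈⟨ -‿inverseʳ 0# ⟩
      0#
    ∎
  ... | inj₂ ≡.refl = begin
      ∇ (suc m) (λ k → binom k m) (suc n)
    ≈⟨ ∇-suc m (λ k → binom k m) n ⟩
      ∇ m (λ k → binom k m) (suc n) - ∇ m (λ k → binom k m) n
    ≈⟨ +-cong (∇-binom ≤-refl (m≤n⇒m≤1+n m≤n)) (-‿cong (∇-binom ≤-refl m≤n)) ⟩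
      binom (suc n ∸ m) (m ∸ m) - binom (n ∸ m) (m ∸ m)
    ≈⟨ +-cong (binom-n[m∸m]≈1 (suc n ∸ m)) (-‿cong (binom-n[m∸m]≈1 (n ∸ m))) ⟩
      1# - 1#
    ≈⟨ -‿inverseʳ 1# ⟩
      0#
    ∎
    where
    binom-n[m∸m]≈1 : ∀ k → binom k (m ∸ m) ≈ 1#
    binom-n[m∸m]≈1 k = trans (⟦⟧-cong (cong (k C_) (n∸n≡0 m))) (binom-n0≈1 k)

  identity₂ : ∀ x y a b → lhs₂ (suc x) (suc y) a b ≈ a (suc x) * b (suc y)
  identity₂ x y a b = begin
      lhs₂ (suc x) (suc y) a b
    ≈⟨ ∑-cong (suc y) (λ {i} _ → *-distribˡ-∑ (suc y ∸ i) (binom (x ℕ.+ i) x) (summand i)) ⟩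
      (∑< suc y) (λ i → (∑< (suc y ∸ i)) (G i))
    ≈⟨ ∑-triangle (suc y) G ⟩
      (∑< suc y) (λ m → (∑< suc m) (λ i → G i (m ∸ i)))
    ≈⟨ ∑-cong (suc y) (λ {m} _ → antidiagonal m) ⟩
      (∑< suc y) T
    ≈⟨ ∑-truncate T (s≤s z≤n) T-vanish ⟩
      0# + T 0
    ≈⟨ trans (+-identityˡ _) (*-congʳ (∇-zero (λ _ → binom (x ℕ.+ 0) x) 0)) ⟩
      binom (x ℕ.+ 0) x * (a (suc (x ℕ.+ 0)) * b (suc y))
    ≡⟨ cong (λ p → binom p x * (a (suc p) * b (suc y))) (ℕₚ.+-identityʳ x) ⟩
      binom x x * (a (suc x) * b (suc y))
    ≈⟨ trans (*-congʳ (binom-nn≈1 x)) (*-identityˡ _) ⟩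
      a (suc x) * b (suc y)
    ∎
    where
    summand G : ℕ → ℕ → Carrier
    summand i j = sgn j * binom (x ℕ.+ i ℕ.+ j) j * a (suc (x ℕ.+ i ℕ.+ j)) * b (suc y ∸ i ∸ j)
    G i j = binom (x ℕ.+ i) x * summand i j
    ab : ℕ → Carrier
    ab m = a (suc (x ℕ.+ m)) * b (suc y ∸ m)
    T : ℕ → Carrier
    T m = ∇ m (λ _ → binom (x ℕ.+ m) x) m * ab m
    T-vanish : ∀ {m} → 1 ≤ m → m < suc y → T m ≈ 0#
    T-vanish {suc m} _ _ = trans (*-congʳ (∇-const m _ (suc m))) (zeroˡ _)
    antidiagonal : ∀ m → (∑< suc m) (λ i → G i (m ∸ i)) ≈ T m
    antidiagonal m = begin
        (∑< suc m) (λ i → G i (m ∸ i))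
      ≈⟨ ∑-cong (suc m) (λ i<1+m → G-antidiagonal (≤-pred i<1+m)) ⟩
        (∑< suc m) (λ i → coeff i * ab m)
      ≈⟨ *-distribʳ-∑ (suc m) (ab m) coeff ⟨
        (∑< suc m) coeff * ab m
      ≈⟨ *-congʳ (trans (∑-reverse (suc m) coeff)
                        (∑-cong (suc m) (λ i<1+m → coeff-reversed (≤-pred i<1+m)))) ⟩
        T m
      ∎
      where
      coeff : ℕ → Carrier
      coeff i = binom (x ℕ.+ i) x * (sgn (m ∸ i) * binom (x ℕ.+ m) (m ∸ i))
      G-antidiagonal : ∀ {i} → i ≤ m → G i (m ∸ i) ≈ coeff i * ab m
      G-antidiagonal {i} i≤m = begin
          G i (m ∸ i)
        ≡⟨ cong₂ (λ p q → binom (x ℕ.+ i) x * (sgn (m ∸ i) * binom p (m ∸ i) * a (suc p) * b q))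
                 (≡.trans (ℕₚ.+-assoc x i (m ∸ i)) (cong (x ℕ.+_) (m+[n∸m]≡n i≤m)))
                 ([n∸i]∸[m∸i]≡n∸m (suc y) i≤m) ⟩
          binom (x ℕ.+ i) x * (sgn (m ∸ i) * binom (x ℕ.+ m) (m ∸ i) * a (suc (x ℕ.+ m)) * b (suc y ∸ m))
        ≈⟨ solve 5 (λ A s B p q → A :* (s :* B :* p :* q) := A :* (s :* B) :* (p :* q)) refl _ _ _ _ _ ⟩
          coeff i * ab m
        ∎
      coeff-reversed : ∀ {i} → i ≤ m → coeff (m ∸ i) ≈ sgn i * binom m i * binom (x ℕ.+ m) x
      coeff-reversed {i} i≤m = begin
          binom (x ℕ.+ (m ∸ i)) x * (sgn (m ∸ (m ∸ i)) * binom (x ℕ.+ m) (m ∸ (m ∸ i)))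
        ≡⟨ cong (λ k → binom (x ℕ.+ (m ∸ i)) x * (sgn k * binom (x ℕ.+ m) k)) (m∸[m∸n]≡n i≤m) ⟩
          binom (x ℕ.+ (m ∸ i)) x * (sgn i * binom (x ℕ.+ m) i)
        ≈⟨ solve 3 (λ A s B → A :* (s :* B) := s :* (B :* A)) refl _ _ _ ⟩
          sgn i * (binom (x ℕ.+ m) i * binom (x ℕ.+ (m ∸ i)) x)
        ≈⟨ *-congˡ (trans (sym (⟦⟧-homo-* ((x ℕ.+ m) C i) _))
                   (trans (⟦⟧-cong revision) (⟦⟧-homo-* ((x ℕ.+ m) C x) _))) ⟩
          sgn i * (binom (x ℕ.+ m) x * binom m i)
        ≈⟨ solve 3 (λ s A B → s :* (A :* B) := s :* B :* A) refl _ _ _ ⟩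
          sgn i * binom m i * binom (x ℕ.+ m) x
        ∎
        where
        revision : ((x ℕ.+ m) C i) ℕ.* ((x ℕ.+ (m ∸ i)) C x) ≡ ((x ℕ.+ m) C x) ℕ.* (m C i)
        revision = ≡.subst₂ (λ p q → ((x ℕ.+ m) C i) ℕ.* (p C x) ≡ ((x ℕ.+ m) C x) ℕ.* (q C i))
          (+-∸-assoc x i≤m) (m+n∸m≡n x m)
          (nCi*[n∸i]Cj≡nCj*[n∸j]Ci {x ℕ.+ m} {i} {x}
            (≡.subst (_≤ x ℕ.+ m) (ℕₚ.+-comm x i) (+-monoʳ-≤ x i≤m)))

  diffConvolution : ℕ → ℕ → (ℕ → Carrier) → (ℕ → Carrier) → Carrier
  diffConvolution x n a b = (∑< suc n) λ m → ∇ m (λ k → binom k x) n * (a (suc m) * b (suc n ∸ m))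

  lhs₁≈-diffConvolution : ∀ x y a b → lhs₁ (suc x) (suc y) a b ≈ - diffConvolution x (x ℕ.+ y) a b
  lhs₁≈-diffConvolution x y a b = begin
      lhs₁ (suc x) (suc y) a b
    ≈⟨ ∑-reverse (suc y) (λ i → row (x ℕ.+ i) (suc (x ℕ.+ i)) (suc y ∸ i)) ⟩
      (∑< suc y) (λ i → row (x ℕ.+ (y ∸ i)) (suc (x ℕ.+ (y ∸ i))) (suc y ∸ (y ∸ i)))
    ≈⟨ ∑-cong (suc y) (λ i<1+y → row-reversed (≤-pred i<1+y)) ⟩
      (∑< suc y) row′
    ≈⟨ ∑-truncate row′ (s≤s (m≤n+m y x)) row′-vanish ⟨
      (∑< suc n) row′
    ≈⟨ ∑-cong (suc n) (λ {i} _ → *-distribˡ-∑ (suc n ∸ i) (binom (n ∸ i) x) (K i)) ⟩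
      (∑< suc n) (λ i → (∑< (suc n ∸ i)) (G i))
    ≈⟨ ∑-triangle (suc n) G ⟩
      (∑< suc n) (λ m → (∑< suc m) (λ i → G i (m ∸ i)))
    ≈⟨ ∑-cong (suc n) (λ {m} _ → antidiagonal m) ⟩
      (∑< suc n) (λ m → - T m)
    ≈⟨ -‿distrib-∑ (suc n) T ⟨
      - diffConvolution x n a b
    ∎
    where
    n = x ℕ.+ y
    -- the summand of lhs₁ with its index expressions abstracted, so that reversing i is a congruence
    row : ℕ → ℕ → ℕ → Carrier
    row p s q = binom p x * (∑< s) λ j → sgn q * binom (q ℕ.+ j ∸ 1) j * a (q ℕ.+ j) * b (s ∸ j)
    K G : ℕ → ℕ → Carrier
    K i j = sgn (suc i) * binom (i ℕ.+ j) j * a (suc (i ℕ.+ j)) * b (suc n ∸ i ∸ j)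
    G i j = binom (n ∸ i) x * K i j
    row′ T ab : ℕ → Carrier
    row′ i = row (n ∸ i) (suc n ∸ i) (suc i)
    ab m = a (suc m) * b (suc n ∸ m)
    T m = ∇ m (λ k → binom k x) n * ab m
    row-reversed : ∀ {i} → i ≤ y → row (x ℕ.+ (y ∸ i)) (suc (x ℕ.+ (y ∸ i))) (suc y ∸ (y ∸ i)) ≈ row′ i
    row-reversed {i} i≤y = reflexive (≡.trans
      (cong (row (x ℕ.+ (y ∸ i)) (suc (x ℕ.+ (y ∸ i)))) ([1+m]∸[m∸n]≡1+n i≤y))
      (cong₂ (λ p s → row p s (suc i)) (≡.sym (+-∸-assoc x i≤y)) (≡.sym (+-∸-assoc (suc x) i≤y))))
    row′-vanish : ∀ {i} → suc y ≤ i → i < suc n → row′ i ≈ 0#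
    row′-vanish {i} y<i i<1+n = trans (*-congʳ (k>n⇒binom-nk≈0 n∸i<x)) (zeroˡ _)
      where n∸i<x = ≡.subst (n ∸ i <_) (m+n∸n≡m x y) (∸-monoʳ-< y<i (≤-pred i<1+n))
    G-antidiagonal : ∀ m {i} → i ≤ m → G i (m ∸ i) ≈ sgn (suc i) * binom m i * binom (n ∸ i) x * ab m
    G-antidiagonal m {i} i≤m = begin
        G i (m ∸ i)
      ≡⟨ cong (λ B → binom (n ∸ i) x *
                       (sgn (suc i) * ⟦ B ⟧ * a (suc (i ℕ.+ (m ∸ i))) * b (suc n ∸ i ∸ (m ∸ i))))
              (≡.sym ([m+n]Cm≡[m+n]Cn i (m ∸ i))) ⟩
        binom (n ∸ i) x *
          (sgn (suc i) * binom (i ℕ.+ (m ∸ i)) i * a (suc (i ℕ.+ (m ∸ i))) * b (suc n ∸ i ∸ (m ∸ i)))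
      ≡⟨ cong₂ (λ p q → binom (n ∸ i) x * (sgn (suc i) * binom p i * a (suc p) * b q))
               (m+[n∸m]≡n i≤m) ([n∸i]∸[m∸i]≡n∸m (suc n) i≤m) ⟩
        binom (n ∸ i) x * (sgn (suc i) * binom m i * a (suc m) * b (suc n ∸ m))
      ≈⟨ solve 5 (λ A s B p q → A :* (s :* B :* p :* q) := s :* B :* A :* (p :* q)) refl _ _ _ _ _ ⟩
        sgn (suc i) * binom m i * binom (n ∸ i) x * ab m
      ∎
    antidiagonal : ∀ m → (∑< suc m) (λ i → G i (m ∸ i)) ≈ - T m
    antidiagonal m = begin
        (∑< suc m) (λ i → G i (m ∸ i))
      ≈⟨ ∑-cong (suc m) (λ i<1+m → G-antidiagonal m (≤-pred i<1+m)) ⟩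
        (∑< suc m) (λ i → sgn (suc i) * binom m i * binom (n ∸ i) x * ab m)
      ≈⟨ *-distribʳ-∑ (suc m) (ab m) _ ⟨
        (∑< suc m) (λ i → sgn (suc i) * binom m i * binom (n ∸ i) x) * ab m
      ≈⟨ *-congʳ (∑-sgn-suc≈-∇ m (λ k → binom k x) n) ⟩
        - ∇ m (λ k → binom k x) n * ab m
      ≈⟨ -‿distribˡ-* _ _ ⟨
        - T m
      ∎

  rhs₁≈-diffConvolution : ∀ x y a b → rhs₁ (suc x) (suc y) a b ≈ - diffConvolution x (x ℕ.+ y) a b
  rhs₁≈-diffConvolution x y a b = -‿cong (begin
      (∑< suc x) col
    ≈⟨ ∑-reverse (suc x) col ⟩
      (∑< suc x) (λ m → col (x ∸ m))
    ≈⟨ ∑-cong (suc x) (λ m<1+x → col-reversed (≤-pred m<1+x)) ⟩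
      (∑< suc x) T
    ≈⟨ ∑-truncate T (s≤s (m≤m+n x y)) T-vanish ⟨
      diffConvolution x n a b
    ∎)
    where
    n = x ℕ.+ y
    col T : ℕ → Carrier
    col i = binom (y ℕ.+ i) y * a (suc x ∸ i) * b (suc (y ℕ.+ i))
    T m = ∇ m (λ k → binom k x) n * (a (suc m) * b (suc n ∸ m))
    T-vanish : ∀ {m} → suc x ≤ m → m < suc n → T m ≈ 0#
    T-vanish x<m m<1+n = trans (*-congʳ (∇-binom-vanish x<m (≤-pred m<1+n))) (zeroˡ _)
    col-reversed : ∀ {m} → m ≤ x → col (x ∸ m) ≈ T m
    col-reversed {m} m≤x = begin
        col (x ∸ m)
      ≡⟨ cong (λ B → ⟦ B ⟧ * a (suc x ∸ (x ∸ m)) * b (suc (y ℕ.+ (x ∸ m)))) ([m+n]Cm≡[m+n]Cn y (x ∸ m)) ⟩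
        binom (y ℕ.+ (x ∸ m)) (x ∸ m) * a (suc x ∸ (x ∸ m)) * b (suc (y ℕ.+ (x ∸ m)))
      ≡⟨ cong₂ (λ p q → binom p (x ∸ m) * a q * b (suc p)) y+[x∸m]≡n∸m ([1+m]∸[m∸n]≡1+n m≤x) ⟩
        binom (n ∸ m) (x ∸ m) * a (suc m) * b (suc (n ∸ m))
      ≡⟨ cong (λ q → binom (n ∸ m) (x ∸ m) * a (suc m) * b q) (≡.sym (+-∸-assoc 1 m≤n)) ⟩
        binom (n ∸ m) (x ∸ m) * a (suc m) * b (suc n ∸ m)
      ≈⟨ trans (*-assoc _ _ _) (*-congʳ (sym (∇-binom m≤x m≤n))) ⟩
        T m
      ∎
      where
      m≤n = ≤-trans m≤x (m≤m+n x y)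
      y+[x∸m]≡n∸m = ≡.trans (≡.sym (+-∸-assoc y m≤x)) (cong (_∸ m) (ℕₚ.+-comm y x))

  identity₁ : ∀ x y a b → lhs₁ (suc x) (suc y) a b ≈ rhs₁ (suc x) (suc y) a b
  identity₁ x y a b = trans (lhs₁≈-diffConvolution x y a b) (sym (rhs₁≈-diffConvolution x y a b))

lemma3p2 : {c ℓ : Level} (R : CommutativeRing c ℓ) (k₁ k₂ : ℕ) → 1 ≤ k₁ → 1 ≤ k₂
           → (a b : ℕ → CommutativeRing.Carrier R)
           → CommutativeRing._≈_ R (RingOps.lhs₁ R k₁ k₂ a b) (RingOps.rhs₁ R k₁ k₂ a b)
             × CommutativeRing._≈_ R (RingOps.lhs₂ R k₁ k₂ a b) (CommutativeRing._*_ R (a k₁) (b k₂))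
lemma3p2 R (suc x) (suc y) _ _ a b = identity₁ R x y a b , identity₂ R x y a b
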